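{- Let $k\geq 2$ and $1\leq l<k$ be integers, and let $K_{k+l}^{(k)}$ be the complete $k$-graph on $k+l$ vertices, with maximum degree $\Delta=\binom{k+l-1}{k-1}$. Then \[ 1-\frac{1}{\Delta}\leq \mathrm{d}_{\mathrm{crit}}(K_{k+l}^{(k)})\leq 1-\frac{1}{(l+1)\Delta}. \]
   Context: A $k$-graph $H$ has vertex set $V(H)$ and edge set $E(H)\subseteq\binom{V(H)}{k}$; its maximum degree $\Delta$ is the maximum over vertices $v$ of the number of edges containing $v$. Given $H$ with $V(H)=\{v_1,\dots,v_h\}$, a complete blow-up $\hat H$ is obtained by replacing each $v_i$ by a non-empty class $A_i$ of $a_i$ vertices (classes disjoint) and taking as edges all $k$-sets containing exactly one vertex from each of $A_{b_1},\dots,A_{b_k}$ for every edge $v_{b_1}\cdots v_{b_k}\in E(H)$. A blow-up of $H$ is any subgraph $G\subseteq\hat H$. For $e\in E(H)$, $G[e]$ is the $k$-partite subgraph of $G$ induced by $\bigcup_{v_i\in e}A_i$, $d_e(G)=|E(G[e])|/\prod_{v_i\in e}a_i$, and $d(G)=\min_{e\in E(H)}d_e(G)$. An $H$-transversal in $G$ is a subgraph of $G$ isomorphic to $H$ with exactly one vertex in each class $A_i$; $G$ is $H$-free if it contains no $H$-transversal. The critical edge density is $\mathrm{d}_{\mathrm{crit}}(H)=\sup\{d(G): G \text{ is an } H\text{ -free blow-up of } H\}$. -}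

module Defs where

open import Data.Nat using (ℕ; zero; suc; _≤_)
open import Data.Fin using (Fin; zero; suc)
open import Data.List using (List; []; _∷_; [_]; map; _++_; length; filterᵇ; foldr; allFin)
open import Data.Nat.ListAction using (product)
open import Data.List.Relation.Unary.All using (All)
open import Data.Bool using (Bool; T)
open import Data.Unit using (⊤; tt)
open import Data.Product using (Σ; _×_; _,_)
open import Relation.Nullary using (¬_)
open import Data.Integer using (+_)
open import Data.Rational using (ℚ; _/_; 0ℚ; 1ℚ; _⊓_; _-_; _<_)
import Data.Rational
import Data.List

-- n / d as a rational, with the (never used) convention n / 0 = 0.
frac : ℕ → ℕ → ℚ
frac n zero    = 0ℚ
frac n (suc d) = (+ n) / suc d

-- All k-element subsets of Fin n, as strictly increasing lists.
combinations : (n k : ℕ) → List (List (Fin n))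
combinations n       zero    = [ [] ]
combinations zero    (suc k) = []
combinations (suc n) (suc k) =
  map (λ xs → zero ∷ map suc xs) (combinations n k) ++ map (map suc) (combinations n (suc k))

-- A k-graph on vertex set Fin h is given by its list of edges
-- (each edge a list of k distinct vertices, edges pairwise distinct).
-- The complete k-graph K_n^(k) on Fin n:
completeEdges : (n k : ℕ) → List (List (Fin n))
completeEdges n k = combinations n k

-- Blow-ups with class sizes a : Fin h → ℕ (class A_i = Fin (a i)).
-- An edge of the complete blow-up over the H-edge e = v_{b_1} … v_{b_k}
-- is a choice of one vertex in each of A_{b_1}, …, A_{b_k}.
Choice : {h : ℕ} → (Fin h → ℕ) → List (Fin h) → Set
Choice a []       = ⊤
Choice a (i ∷ is) = Fin (a i) × Choice a is

allChoices : {h : ℕ} (a : Fin h → ℕ) (e : List (Fin h)) → List (Choice a e)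
allChoices a []       = [ tt ]
allChoices a (i ∷ is) =
  Data.List.concatMap (λ x → map (λ c → x , c) (allChoices a is)) (allFin (a i))

-- A blow-up G ⊆ Ĥ: for each H-edge e, (decidable) set of edges of G[e].
BlowUp : {h : ℕ} → (Fin h → ℕ) → Set
BlowUp {h} a = (e : List (Fin h)) → Choice a e → Bool

edgeCount : {h : ℕ} (a : Fin h → ℕ) → BlowUp a → List (Fin h) → ℕ
edgeCount a G e = length (filterᵇ (G e) (allChoices a e))

density : {h : ℕ} (a : Fin h → ℕ) → BlowUp a → List (Fin h) → ℚ
density a G e = frac (edgeCount a G e) (product (map a e))

-- d(G) = min_{e ∈ E(H)} d_e(G)   (all densities are ≤ 1, so starting the fold at 1 is harmless)
minDensity : {h : ℕ} (E : List (List (Fin h))) (a : Fin h → ℕ) → BlowUp a → ℚ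
minDensity E a G = foldr (λ e r → density a G e ⊓ r) 1ℚ E

restrict : {h : ℕ} (a : Fin h → ℕ) → ((i : Fin h) → Fin (a i)) → (e : List (Fin h)) → Choice a e
restrict a x []       = tt
restrict a x (i ∷ is) = x i , restrict a x is

-- An H-transversal: one vertex x_i in each class such that every edge of H,
-- realised on these vertices, is an edge of G (since G ⊆ Ĥ this is exactly a
-- copy of H with one vertex per class).
HTransversal : {h : ℕ} (E : List (List (Fin h))) (a : Fin h → ℕ) → BlowUp a → ((i : Fin h) → Fin (a i)) → Set
HTransversal E a G x = All (λ e → T (G e (restrict a x e))) E

HFree : {h : ℕ} (E : List (List (Fin h))) (a : Fin h → ℕ) → BlowUp a → Set
HFree {h} E a G = ¬ (Σ ((i : Fin h) → Fin (a i)) (HTransversal E a G))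

-- d_crit(H) = sup { d(G) : G an H-free blow-up of H }  (all classes non-empty).
-- x ≤ d_crit(H)  ⇔  for every ε > 0 some H-free blow-up has d(G) > x - ε.
CritAtLeast : {h : ℕ} (E : List (List (Fin h))) → ℚ → Set
CritAtLeast {h} E x =
  (ε : ℚ) → 0ℚ < ε →
  Σ (Fin h → ℕ) λ a → ((i : Fin h) → 1 ≤ a i) ×
    Σ (BlowUp a) λ G → HFree E a G × (x - ε < minDensity E a G)

-- d_crit(H) ≤ x  ⇔  every H-free blow-up has d(G) ≤ x.
CritAtMost : {h : ℕ} (E : List (List (Fin h))) → ℚ → Set
CritAtMost {h} E x =
  (a : Fin h → ℕ) → ((i : Fin h) → 1 ≤ a i) →
  (G : BlowUp a) → HFree E a G → minDensity E a G Data.Rational.≤ x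

-- Upper bound: if d(G) > 1 - 1/N with N = (l + 1)Δ, which is at least the number of edges,
-- then on each edge e fewer than a 1/N fraction of the choices of one vertex per class of e are
-- missing from G, so by the union bound over the edges some transversal has all its edges in G.
-- Lower bound: give one vertex v a class with one vertex for each of the Δ edges through v and
-- let each such vertex miss only its own edge. Every transversal misses an edge, and every
-- edge density is at least 1 - 1/Δ.

module Submission where

open import Data.Bool using (Bool; true; false; not; T; T?; if_then_else_)
open import Data.Unit using (tt)
open import Data.Empty using (⊥-elim)
open import Data.Fin as Fin using (Fin; zero; suc)
import Data.Fin.Properties as Fin
import Data.Integer as ℤ
import Data.Integer.Properties as ℤ
open import Data.List using (List; []; _∷_; [_]; map; _++_; length; filterᵇ; allFin; concatMap; lookup)
import Data.List.Properties as List
open import Data.List.Membership.Propositional.Properties using (∈-lookup; ∈-map⁺; ∈-++⁺ˡ)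
open import Data.List.Relation.Unary.All as All using (All; []; _∷_)
import Data.List.Relation.Unary.All.Properties as All
open import Data.Nat using (ℕ; zero; suc; z≤n; s≤s; _+_; _*_; _∸_; _≤_; _<_; >-nonZero)
open import Data.Nat.Combinatorics using (_C_; nCk+nC[k+1]≡[n+1]C[k+1])
open import Data.Nat.ListAction using (sum; product)
open import Data.Nat.Properties
open import Algebra.Properties.CommutativeSemigroup *-commutativeSemigroup using (x∙yz≈y∙xz)
open import Algebra.Properties.CommutativeSemigroup +-commutativeSemigroup
  using () renaming (interchange to +-interchange)
open import Data.Vec using (Vec; []; _∷_; replicate)
open import Data.Product using (Σ; _×_; _,_)
open import Data.Rational as ℚ using (ℚ; 1ℚ; _-_)
import Data.Rational.Properties as ℚ
open import Data.Rational.Unnormalised as ℚᵘ using (mkℚᵘ; *≡*; *≤*; *<*)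
import Data.Rational.Unnormalised.Properties as ℚᵘ
open import Function using (_∘_; _∘₂_; id; case_of_)
open import Relation.Binary.PropositionalEquality hiding ([_])
open import Relation.Nullary using (yes; no; ¬_)
open import Relation.Nullary.Decidable using (⌊_⌋; toWitness)
open import Relation.Binary.Definitions using (DecidableEquality)

open import Defs

private variable
  A B : Set

count : (A → Bool) → List A → ℕ
count p xs = length (filterᵇ p xs)

count-map : (p : B → Bool) (f : A → B) (xs : List A) → count p (map f xs) ≡ count (p ∘ f) xs
count-map p f [] = refl
count-map p f (x ∷ xs) with p (f x)
... | true  = cong suc (count-map p f xs)
... | false = count-map p f xs

count-++ : (p : A → Bool) (xs ys : List A) → count p (xs ++ ys) ≡ count p xs + count p ys
count-++ p xs ys = trans (cong length (List.filter-++ _ xs ys)) (List.length-++ (filterᵇ p xs))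

count-concatMap : (p : B → Bool) (f : A → List B) (xs : List A) →
  count p (concatMap f xs) ≡ sum (map (count p ∘ f) xs)
count-concatMap p f []       = refl
count-concatMap p f (x ∷ xs) = trans (count-++ p (f x) (concatMap f xs)) (cong (count p (f x) +_) (count-concatMap p f xs))

count-not+count : (p : A → Bool) (xs : List A) → count (not ∘ p) xs + count p xs ≡ length xs
count-not+count p [] = refl
count-not+count p (x ∷ xs) with p x
... | true  = trans (+-suc _ _) (cong suc (count-not+count p xs))
... | false = cong suc (count-not+count p xs)

count-const : (b : Bool) (xs : List A) → count (λ _ → b) xs ≡ (if b then length xs else 0)
count-const true  []       = refl
count-const true  (x ∷ xs) = cong suc (count-const true xs)
count-const false []       = refl
count-const false (x ∷ xs) = count-const false xs

sum-count-const : (q : A → Bool) (xs : List A) (ys : List B) →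
  sum (map (λ x → count (λ _ → q x) ys) xs) ≡ count q xs * length ys
sum-count-const q []       ys = refl
sum-count-const q (x ∷ xs) ys with q x
... | true  = cong₂ _+_ (count-const true ys) (sum-count-const q xs ys)
... | false = cong₂ _+_ (count-const false ys) (sum-count-const q xs ys)

count-pos⇒witness : (p : A → Bool) (xs : List A) → 1 ≤ count p xs → Σ A (T ∘ p)
count-pos⇒witness p (x ∷ xs) pos with p x in eq
... | true  = x , subst T (sym eq) tt
... | false = count-pos⇒witness p xs pos

length-concatMap : (f : A → List B) (xs : List A) → length (concatMap f xs) ≡ sum (map (length ∘ f) xs)
length-concatMap f []       = refl
length-concatMap f (x ∷ xs) = trans (List.length-++ (f x)) (cong (length (f x) +_) (length-concatMap f xs))

sum-map-const : (c : ℕ) (xs : List A) → sum (map (λ _ → c) xs) ≡ length xs * c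
sum-map-const c []       = refl
sum-map-const c (x ∷ xs) = cong (c +_) (sum-map-const c xs)

sum-map-*ʳ : (f : A → ℕ) (c : ℕ) (xs : List A) → sum (map (λ x → f x * c) xs) ≡ sum (map f xs) * c
sum-map-*ʳ f c []       = refl
sum-map-*ʳ f c (x ∷ xs) = trans (cong (f x * c +_) (sum-map-*ʳ f c xs)) (sym (*-distribʳ-+ c (f x) _))

sum-map-+ : (f g : A → ℕ) (xs : List A) → sum (map (λ x → f x + g x) xs) ≡ sum (map f xs) + sum (map g xs)
sum-map-+ f g []       = refl
sum-map-+ f g (x ∷ xs) = trans (cong (f x + g x +_) (sum-map-+ f g xs)) (+-interchange (f x) (g x) _ _)

sum-map-swap : (f : A → B → ℕ) (xs : List A) (ys : List B) →
  sum (map (λ x → sum (map (f x) ys)) xs) ≡ sum (map (λ y → sum (map (λ x → f x y) xs)) ys)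
sum-map-swap f xs []       = trans (sum-map-const 0 xs) (*-zeroʳ (length xs))
sum-map-swap f xs (y ∷ ys) =
  trans (sum-map-+ (λ x → f x y) (λ x → sum (map (f x) ys)) xs) (cong (_ +_) (sum-map-swap f xs ys))

pigeonhole : (f : A → ℕ) (xs : List A) {t : ℕ} → sum (map f xs) < length xs * t → Σ A λ x → f x < t
pigeonhole f (x ∷ xs) {t} lt with f x <? t
... | yes fx<t = x , fx<t
... | no  fx≮t = pigeonhole f xs (+-cancelˡ-< t _ _ (≤-<-trans (+-monoˡ-≤ _ (≮⇒≥ fx≮t)) lt))

sum<1⇒all≡0 : (f : A → ℕ) (xs : List A) → sum (map f xs) < 1 → All (λ x → f x ≡ 0) xs
sum<1⇒all≡0 f []       _         = []
sum<1⇒all≡0 f (x ∷ xs) (s≤s le) =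
  m+n≡0⇒m≡0 (f x) (n≤0⇒n≡0 le) ∷ sum<1⇒all≡0 f xs (s≤s (≤-reflexive (m+n≡0⇒n≡0 (f x) (n≤0⇒n≡0 le))))

*sum+length≤length* : (f : A → ℕ) (n t : ℕ) (xs : List A) →
  All (λ x → n * f x < t) xs → n * sum (map f xs) + length xs ≤ length xs * t
*sum+length≤length* f n t []       []          = ≤-reflexive (trans (+-identityʳ (n * 0)) (*-zeroʳ n))
*sum+length≤length* f n t (x ∷ xs) (lt ∷ lts) = begin
  n * (f x + sum (map f xs)) + suc (length xs)    ≡⟨ cong (_+ suc (length xs)) (*-distribˡ-+ n (f x) _) ⟩
  n * f x + n * sum (map f xs) + suc (length xs)  ≡⟨ +-suc (n * f x + _) (length xs) ⟩
  suc (n * f x + n * sum (map f xs) + length xs)  ≡⟨ cong suc (+-assoc (n * f x) _ (length xs)) ⟩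
  suc (n * f x) + (n * sum (map f xs) + length xs) ≤⟨ +-mono-≤ lt (*sum+length≤length* f n t xs lts) ⟩
  t + length xs * t                                ∎
  where open ≤-Reasoning

all-*<⇒sum< : (f : A → ℕ) {n t : ℕ} (xs : List A) → 1 ≤ t → length xs ≤ n → All (λ x → n * f x < t) xs →
  sum (map f xs) < t
all-*<⇒sum< f         []         t≥1 _     _   = t≥1
all-*<⇒sum< f {n} {t} xs@(_ ∷ _) _   len≤n lts = *-cancelˡ-< n _ _ (begin-strict
  n * sum (map f xs)              <⟨ m<m+n _ (s≤s z≤n) ⟩
  n * sum (map f xs) + length xs  ≤⟨ *sum+length≤length* f n t xs lts ⟩
  length xs * t                   ≤⟨ *-monoˡ-≤ t len≤n ⟩
  n * t                           ∎)
  where open ≤-Reasoning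

toℚᵘ-frac : ∀ c p → ℚ.toℚᵘ (frac c (suc p)) ℚᵘ.≃ mkℚᵘ (ℤ.+ c) p
toℚᵘ-frac c p = ℚ.toℚᵘ-fromℚᵘ (mkℚᵘ (ℤ.+ c) p)

frac-mono-≤ : ∀ {c d p q} → c * suc q ≤ d * suc p → frac c (suc p) ℚ.≤ frac d (suc q)
frac-mono-≤ {c} {d} {p} {q} le = ℚ.toℚᵘ-cancel-≤
  (ℚᵘ.≤-respˡ-≃ (ℚᵘ.≃-sym (toℚᵘ-frac c p)) (ℚᵘ.≤-respʳ-≃ (ℚᵘ.≃-sym (toℚᵘ-frac d q))
    (*≤* (subst₂ ℤ._≤_ (ℤ.pos-* c (suc q)) (ℤ.pos-* d (suc p)) (ℤ.+≤+ le)))))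

frac-cancel-< : ∀ {c d p q} → frac c (suc p) ℚ.< frac d (suc q) → c * suc q < d * suc p
frac-cancel-< {c} {d} {p} {q} lt
  with ℚᵘ.<-respˡ-≃ (toℚᵘ-frac c p) (ℚᵘ.<-respʳ-≃ (toℚᵘ-frac d q) (ℚ.toℚᵘ-mono-< lt))
... | *<* lt′ = ℤ.drop‿+<+ (subst₂ ℤ._<_ (sym (ℤ.pos-* c (suc q))) (sym (ℤ.pos-* d (suc p))) lt′)

1-1/[1+n]≡n/[1+n] : ∀ n → 1ℚ - frac 1 (suc n) ≡ frac n (suc n)
1-1/[1+n]≡n/[1+n] n = ℚ.toℚᵘ-injective (begin
  ℚ.toℚᵘ (1ℚ - frac 1 (suc n))                   ≈⟨ ℚ.toℚᵘ-homo-+ 1ℚ (ℚ.- frac 1 (suc n)) ⟩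
  ℚᵘ.1ℚᵘ ℚᵘ.+ ℚ.toℚᵘ (ℚ.- frac 1 (suc n))        ≈⟨ ℚᵘ.+-congʳ ℚᵘ.1ℚᵘ (ℚ.toℚᵘ-homo‿- (frac 1 (suc n))) ⟩
  ℚᵘ.1ℚᵘ ℚᵘ.- ℚ.toℚᵘ (frac 1 (suc n))            ≈⟨ ℚᵘ.+-congʳ ℚᵘ.1ℚᵘ (ℚᵘ.-‿cong (toℚᵘ-frac 1 n)) ⟩
  ℚᵘ.1ℚᵘ ℚᵘ.- mkℚᵘ (ℤ.+ 1) n                     ≈⟨ *≡* (cong₂ ℤ._*_ (cong ℤ.+_ (+-identityʳ n))
                                                                      (cong (ℤ.+_ ∘ suc) (sym (+-identityʳ n)))) ⟩
  mkℚᵘ (ℤ.+ n) n                                 ≈⟨ ℚᵘ.≃-sym (toℚᵘ-frac n n) ⟩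
  ℚ.toℚᵘ (frac n (suc n))                         ∎)
  where open ℚᵘ.≃-Reasoning

1-1/D≤1 : ∀ D → 1ℚ - frac 1 D ℚ.≤ 1ℚ
1-1/D≤1 zero    = ℚ.≤-refl
1-1/D≤1 (suc n) rewrite 1-1/[1+n]≡n/[1+n] n = frac-mono-≤ {n} {1}
  (subst₂ _≤_ (sym (*-identityʳ n)) (sym (*-identityˡ (suc n))) (n≤1+n n))

1-1/D≤c/D : ∀ {D c} → 1 ≤ D → D ≤ suc c → 1ℚ - frac 1 D ℚ.≤ frac c D
1-1/D≤c/D {suc n} {c} _ (s≤s n≤c) rewrite 1-1/[1+n]≡n/[1+n] n = frac-mono-≤ {n} {c} (*-monoˡ-≤ (suc n) n≤c)

1-1/N<c/P⇒N*[P∸c]<P : ∀ {N P c} → 1 ≤ N → 1 ≤ P → 1ℚ - frac 1 N ℚ.< frac c P → N * (P ∸ c) < P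
1-1/N<c/P⇒N*[P∸c]<P {suc n} {P@(suc p)} {c} _ _ lt rewrite 1-1/[1+n]≡n/[1+n] n =
  subst (_< P) (sym (*-distribˡ-∸ (suc n) P c)) (m<n+o⇒m∸n<o (suc n * P) (suc n * c) NP<Nc+P)
  where
  NP<Nc+P : suc n * P < suc n * c + P
  NP<Nc+P = subst (suc n * P <_) (trans (+-comm P (c * suc n)) (cong (_+ P) (*-comm c (suc n))))
    (+-monoʳ-< P (frac-cancel-< {n} {c} {n} {p} lt))

p-ε<p : (p ε : ℚ) → ℚ.0ℚ ℚ.< ε → p - ε ℚ.< p
p-ε<p p ε ε>0 = subst (p - ε ℚ.<_) (ℚ.+-identityʳ p) (ℚ.+-monoʳ-< p (ℚ.neg-antimono-< ε>0))

members : ∀ {h} → Vec Bool h → List (Fin h)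
members []          = []
members (true  ∷ s) = zero ∷ map suc (members s)
members (false ∷ s) = map suc (members s)

#transversals : ∀ {h} → (Fin h → ℕ) → ℕ
#transversals {zero}  a = 1
#transversals {suc h} a = a zero * #transversals (a ∘ suc)

outside : ∀ {h} → (Fin h → ℕ) → Vec Bool h → ℕ
outside a []          = 1
outside a (true  ∷ s) = outside (a ∘ suc) s
outside a (false ∷ s) = a zero * outside (a ∘ suc) s

Transversal : ∀ {h} → (Fin h → ℕ) → Set
Transversal {h} a = (i : Fin h) → Fin (a i)

_∷ᵗ_ : ∀ {h} {a : Fin (suc h) → ℕ} → Fin (a zero) → Transversal (a ∘ suc) → Transversal a
(j ∷ᵗ x) zero    = j
(j ∷ᵗ x) (suc i) = x i

length-allChoices : ∀ {h} (a : Fin h → ℕ) (e : List (Fin h)) → length (allChoices a e) ≡ product (map a e)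
length-allChoices a []      = refl
length-allChoices a (i ∷ e) = begin
  length (concatMap (λ x → map (x ,_) (allChoices a e)) (allFin (a i)))
    ≡⟨ length-concatMap _ (allFin (a i)) ⟩
  sum (map (λ x → length (map (x ,_) (allChoices a e))) (allFin (a i)))
    ≡⟨ cong sum (List.map-cong (λ x → List.length-map (x ,_) (allChoices a e)) (allFin (a i))) ⟩
  sum (map (λ _ → length (allChoices a e)) (allFin (a i)))
    ≡⟨ sum-map-const _ (allFin (a i)) ⟩
  length (allFin (a i)) * length (allChoices a e)
    ≡⟨ cong₂ _*_ (List.length-tabulate {n = a i} id) (length-allChoices a e) ⟩
  a i * product (map a e) ∎
  where open ≡-Reasoning

product-map-suc : ∀ {h} (a : Fin (suc h) → ℕ) (L : List (Fin h)) → product (map a (map suc L)) ≡ product (map (a ∘ suc) L)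
product-map-suc a L = cong product (sym (List.map-∘ L))

product-members*outside : ∀ {h} (a : Fin h → ℕ) (s : Vec Bool h) → product (map a (members s)) * outside a s ≡ #transversals a
product-members*outside a []          = refl
product-members*outside a (true ∷ s)  = begin
  a zero * product (map a (map suc (members s))) * outside (a ∘ suc) s
    ≡⟨ *-assoc (a zero) _ _ ⟩
  a zero * (product (map a (map suc (members s))) * outside (a ∘ suc) s)
    ≡⟨ cong (λ n → a zero * (n * outside (a ∘ suc) s)) (product-map-suc a (members s)) ⟩
  a zero * (product (map (a ∘ suc) (members s)) * outside (a ∘ suc) s)
    ≡⟨ cong (a zero *_) (product-members*outside (a ∘ suc) s) ⟩
  a zero * #transversals (a ∘ suc) ∎
  where open ≡-Reasoning
product-members*outside a (false ∷ s) = begin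
  product (map a (map suc (members s))) * (a zero * outside (a ∘ suc) s)
    ≡⟨ cong (_* (a zero * outside (a ∘ suc) s)) (product-map-suc a (members s)) ⟩
  product (map (a ∘ suc) (members s)) * (a zero * outside (a ∘ suc) s)
    ≡⟨ x∙yz≈y∙xz (product (map (a ∘ suc) (members s))) (a zero) (outside (a ∘ suc) s) ⟩
  a zero * (product (map (a ∘ suc) (members s)) * outside (a ∘ suc) s)
    ≡⟨ cong (a zero *_) (product-members*outside (a ∘ suc) s) ⟩
  a zero * #transversals (a ∘ suc) ∎
  where open ≡-Reasoning

product-pos : ∀ {h} (a : Fin h → ℕ) → (∀ i → 1 ≤ a i) → (e : List (Fin h)) → 1 ≤ product (map a e)
product-pos a a≥1 []      = s≤s z≤n
product-pos a a≥1 (i ∷ e) = *-mono-≤ (a≥1 i) (product-pos a a≥1 e)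

outside-pos : ∀ {h} (a : Fin h → ℕ) → (∀ i → 1 ≤ a i) → (s : Vec Bool h) → 1 ≤ outside a s
outside-pos a a≥1 []          = s≤s z≤n
outside-pos a a≥1 (true ∷ s)  = outside-pos (a ∘ suc) (a≥1 ∘ suc) s
outside-pos a a≥1 (false ∷ s) = *-mono-≤ (a≥1 zero) (outside-pos (a ∘ suc) (a≥1 ∘ suc) s)

#transversals-pos : ∀ {h} (a : Fin h → ℕ) → (∀ i → 1 ≤ a i) → 1 ≤ #transversals a
#transversals-pos {zero}  a a≥1 = s≤s z≤n
#transversals-pos {suc h} a a≥1 = *-mono-≤ (a≥1 zero) (#transversals-pos (a ∘ suc) (a≥1 ∘ suc))

liftChoice : ∀ {h} {a : Fin (suc h) → ℕ} (L : List (Fin h)) → Choice (a ∘ suc) L → Choice a (map suc L)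
liftChoice []      tt      = tt
liftChoice (i ∷ L) (x , c) = x , liftChoice L c

allChoices-map-suc : ∀ {h} (a : Fin (suc h) → ℕ) (L : List (Fin h)) →
  allChoices a (map suc L) ≡ map (liftChoice L) (allChoices (a ∘ suc) L)
allChoices-map-suc a []      = refl
allChoices-map-suc a (i ∷ L) = sym (begin
  map (liftChoice (i ∷ L)) (concatMap (λ x → map (x ,_) cs) js)
    ≡⟨ List.map-concatMap (liftChoice (i ∷ L)) _ js ⟩
  concatMap (λ x → map (liftChoice (i ∷ L)) (map (x ,_) cs)) js
    ≡⟨ List.concatMap-cong (λ x → trans (sym (List.map-∘ cs)) (List.map-∘ cs)) js ⟩
  concatMap (λ x → map (x ,_) (map (liftChoice L) cs)) js
    ≡⟨ List.concatMap-cong (λ x → cong (map (x ,_)) (sym (allChoices-map-suc a L))) js ⟩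
  concatMap (λ x → map (x ,_) (allChoices a (map suc L))) js ∎)
  where
  open ≡-Reasoning
  cs = allChoices (a ∘ suc) L
  js = allFin (a (suc i))

count-allChoices-map-suc : ∀ {h} (a : Fin (suc h) → ℕ) (L : List (Fin h)) (p : Choice a (map suc L) → Bool) →
  count p (allChoices a (map suc L)) ≡ count (p ∘ liftChoice L) (allChoices (a ∘ suc) L)
count-allChoices-map-suc a L p =
  trans (cong (count p) (allChoices-map-suc a L)) (count-map p (liftChoice L) (allChoices (a ∘ suc) L))

count-allChoices-∷ : ∀ {h} (a : Fin h → ℕ) (i : Fin h) (e : List (Fin h)) (p : Choice a (i ∷ e) → Bool) →
  count p (allChoices a (i ∷ e)) ≡ sum (map (λ j → count (p ∘ (j ,_)) (allChoices a e)) (allFin (a i)))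
count-allChoices-∷ a i e p = trans (count-concatMap p _ (allFin (a i)))
  (cong sum (List.map-cong (λ j → count-map p (j ,_) (allChoices a e)) (allFin (a i))))

restrict-map-suc : ∀ {h} (a : Fin (suc h) → ℕ) (x : Transversal a) (L : List (Fin h)) →
  restrict a x (map suc L) ≡ liftChoice L (restrict (a ∘ suc) (x ∘ suc) L)
restrict-map-suc a x []      = refl
restrict-map-suc a x (i ∷ L) = cong (x (suc i) ,_) (restrict-map-suc a x L)

-- The union bound

-- (s , bad) forbids the choices `bad` on the classes of the vertices in s.
Constraint : ∀ {h} → (Fin h → ℕ) → Set
Constraint {h} a = Σ (Vec Bool h) λ s → Choice a (members s) → Bool

Avoids : ∀ {h} (a : Fin h → ℕ) → Transversal a → Constraint a → Set
Avoids a x (s , bad) = bad (restrict a x (members s)) ≡ false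

violations : ∀ {h} (a : Fin h → ℕ) → Constraint a → ℕ
violations a (s , bad) = count bad (allChoices a (members s)) * outside a s

fixFirst : ∀ {h} {a : Fin (suc h) → ℕ} → Fin (a zero) → Constraint a → Constraint (a ∘ suc)
fixFirst j (true  ∷ s , bad) = s , λ c → bad (j , liftChoice (members s) c)
fixFirst j (false ∷ s , bad) = s , bad ∘ liftChoice (members s)

avoids-fixFirst : ∀ {h} (a : Fin (suc h) → ℕ) (j : Fin (a zero)) (x : Transversal (a ∘ suc)) {c : Constraint a} →
  Avoids (a ∘ suc) x (fixFirst j c) → Avoids a (j ∷ᵗ x) c
avoids-fixFirst a j x {true  ∷ s , bad} = trans (cong (λ c → bad (j , c)) (restrict-map-suc a (j ∷ᵗ x) (members s)))
avoids-fixFirst a j x {false ∷ s , bad} = trans (cong bad (restrict-map-suc a (j ∷ᵗ x) (members s)))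

violations-fixFirst : ∀ {h} (a : Fin (suc h) → ℕ) (c : Constraint a) →
  sum (map (λ j → violations (a ∘ suc) (fixFirst j c)) (allFin (a zero))) ≡ violations a c
violations-fixFirst a (true ∷ s , bad) = begin
  sum (map (λ j → count (bad ∘ (j ,_) ∘ liftChoice ms) cs′ * outside (a ∘ suc) s) js)
    ≡⟨ sum-map-*ʳ (λ j → count (bad ∘ (j ,_) ∘ liftChoice ms) cs′) _ js ⟩
  sum (map (λ j → count (bad ∘ (j ,_) ∘ liftChoice ms) cs′) js) * outside (a ∘ suc) s
    ≡⟨ cong (λ n → n * outside (a ∘ suc) s) (sym (trans (count-allChoices-∷ a zero (map suc ms) bad)
         (cong sum (List.map-cong (λ j → count-allChoices-map-suc a ms (bad ∘ (j ,_))) js)))) ⟩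
  count bad (allChoices a (zero ∷ map suc ms)) * outside (a ∘ suc) s ∎
  where
  open ≡-Reasoning
  ms  = members s
  cs′ = allChoices (a ∘ suc) ms
  js  = allFin (a zero)
violations-fixFirst a (false ∷ s , bad) = begin
  sum (map (λ _ → count (bad ∘ liftChoice ms) cs′ * outside (a ∘ suc) s) js)
    ≡⟨ sum-map-const _ js ⟩
  length js * (count (bad ∘ liftChoice ms) cs′ * outside (a ∘ suc) s)
    ≡⟨ cong₂ (λ m n → m * (n * outside (a ∘ suc) s)) (List.length-tabulate {n = a zero} id) (sym (count-allChoices-map-suc a ms bad)) ⟩
  a zero * (count bad (allChoices a (map suc ms)) * outside (a ∘ suc) s)
    ≡⟨ x∙yz≈y∙xz (a zero) (count bad (allChoices a (map suc ms))) (outside (a ∘ suc) s) ⟩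
  count bad (allChoices a (map suc ms)) * (a zero * outside (a ∘ suc) s) ∎
  where
  open ≡-Reasoning
  ms  = members s
  cs′ = allChoices (a ∘ suc) ms
  js  = allFin (a zero)

no-violations⇒avoids : (a : Fin 0 → ℕ) (c : Constraint a) → violations a c ≡ 0 → Avoids a (λ ()) c
no-violations⇒avoids a ([] , bad) none with bad tt
... | false = refl
... | true  = case none of λ ()

sum-violations-fixFirst : ∀ {h} (a : Fin (suc h) → ℕ) (cs : List (Constraint a)) →
  sum (map (λ j → sum (map (violations (a ∘ suc) ∘ fixFirst j) cs)) (allFin (a zero))) ≡ sum (map (violations a) cs)
sum-violations-fixFirst a cs = trans (sum-map-swap (λ j c → violations (a ∘ suc) (fixFirst j c)) (allFin (a zero)) cs)
  (cong sum (List.map-cong (violations-fixFirst a) cs))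

-- By violations-fixFirst, some vertex of the first class leaves fewer violations than there are
-- transversals of the remaining classes; recurse on those.
union-bound : ∀ {h} (a : Fin h → ℕ) (cs : List (Constraint a)) →
  sum (map (violations a) cs) < #transversals a → Σ (Transversal a) λ x → All (Avoids a x) cs
union-bound {zero} a cs lt =
  (λ ()) , All.map (λ {c} → no-violations⇒avoids a c) (sum<1⇒all≡0 (violations a) cs lt)
union-bound {suc h} a cs lt =
  let j , lt-j = pigeonhole (λ j → sum (map (violations (a ∘ suc) ∘ fixFirst j) cs)) (allFin (a zero))
        (subst₂ _<_ (sym (sum-violations-fixFirst a cs))
                    (cong (_* #transversals (a ∘ suc)) (sym (List.length-tabulate {n = a zero} id))) lt)
      x , avoids = union-bound (a ∘ suc) (map (fixFirst j) cs)
        (subst (_< #transversals (a ∘ suc)) (cong sum (List.map-∘ cs)) lt-j)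
  in  j ∷ᵗ x , All.map (λ {c} → avoids-fixFirst a j x {c}) (All.map⁻ avoids)

subsets : (n k : ℕ) → List (Vec Bool n)
subsets n       zero    = [ replicate n false ]
subsets zero    (suc k) = []
subsets (suc n) (suc k) = map (true ∷_) (subsets n k) ++ map (false ∷_) (subsets n (suc k))

members-replicate-false : ∀ n → members (replicate n false) ≡ []
members-replicate-false zero    = refl
members-replicate-false (suc n) = cong (map suc) (members-replicate-false n)

combinations≡map-members : ∀ n k → combinations n k ≡ map members (subsets n k)
combinations≡map-members n       zero    = cong [_] (sym (members-replicate-false n))
combinations≡map-members zero    (suc k) = refl
combinations≡map-members (suc n) (suc k) = sym (begin
  map members (map (true ∷_) (subsets n k) ++ map (false ∷_) (subsets n (suc k)))
    ≡⟨ List.map-++ members (map (true ∷_) (subsets n k)) _ ⟩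
  map members (map (true ∷_) (subsets n k)) ++ map members (map (false ∷_) (subsets n (suc k)))
    ≡⟨ cong₂ _++_ (sym (List.map-∘ (subsets n k))) (sym (List.map-∘ (subsets n (suc k)))) ⟩
  map (λ s → zero ∷ map suc (members s)) (subsets n k) ++ map (map suc ∘ members) (subsets n (suc k))
    ≡⟨ cong₂ _++_ (List.map-∘ (subsets n k)) (List.map-∘ (subsets n (suc k))) ⟩
  map (λ xs → zero ∷ map suc xs) (map members (subsets n k)) ++ map (map suc) (map members (subsets n (suc k)))
    ≡⟨ cong₂ (λ xss yss → map (λ xs → zero ∷ map suc xs) xss ++ map (map suc) yss)
             (sym (combinations≡map-members n k)) (sym (combinations≡map-members n (suc k))) ⟩
  combinations (suc n) (suc k) ∎)
  where open ≡-Reasoning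

length-combinations-suc : ∀ n k →
  length (combinations (suc n) (suc k)) ≡ length (combinations n k) + length (combinations n (suc k))
length-combinations-suc n k = trans (List.length-++ (map _ (combinations n k)))
  (cong₂ _+_ (List.length-map _ (combinations n k)) (List.length-map _ (combinations n (suc k))))

length-combinations : ∀ n k → length (combinations n k) ≡ n C k
length-combinations n       zero    = refl
length-combinations zero    (suc k) = refl
length-combinations (suc n) (suc k) = trans (length-combinations-suc n k)
  (trans (cong₂ _+_ (length-combinations n k) (length-combinations n (suc k))) (nCk+nC[k+1]≡[n+1]C[k+1] n k))

length-combinations-pos : ∀ {n k} → k ≤ n → 1 ≤ length (combinations n k)
length-combinations-pos {n}     {zero}  _         = s≤s z≤n
length-combinations-pos {suc n} {suc k} (s≤s k≤n) =
  subst (1 ≤_) (sym (length-combinations-suc n k)) (≤-trans (length-combinations-pos k≤n) (m≤m+n _ _))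

-- A weak form of (k + 1) C(n, k + 1) = (n - k) C(n, k).
length-combinations-suc-≤ : ∀ n k → length (combinations n (suc k)) ≤ (n ∸ k) * length (combinations n k)
length-combinations-suc-≤ zero    k       = z≤n
length-combinations-suc-≤ (suc n) zero    =
  ≤-trans (≤-reflexive (length-combinations-suc n zero)) (s≤s (length-combinations-suc-≤ n zero))
length-combinations-suc-≤ (suc n) (suc k) = begin
  length (combinations (suc n) (suc (suc k)))          ≡⟨ length-combinations-suc n (suc k) ⟩
  c₁ + c₂                                              ≤⟨ +-mono-≤ (length-combinations-suc-≤ n k) c₂≤ ⟩
  (n ∸ k) * c₀ + (n ∸ k) * c₁                          ≡⟨ *-distribˡ-+ (n ∸ k) c₀ c₁ ⟨
  (n ∸ k) * (c₀ + c₁)                                  ≡⟨ cong ((n ∸ k) *_) (length-combinations-suc n k) ⟨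
  (n ∸ k) * length (combinations (suc n) (suc k))      ∎
  where
  open ≤-Reasoning
  c₀ = length (combinations n k)
  c₁ = length (combinations n (suc k))
  c₂ = length (combinations n (suc (suc k)))
  c₂≤ : c₂ ≤ (n ∸ k) * c₁
  c₂≤ = ≤-trans (length-combinations-suc-≤ n (suc k)) (*-monoˡ-≤ c₁ (∸-monoʳ-≤ n (n≤1+n k)))

length-complete-≤ : ∀ k l → length (combinations (suc (k + l)) (suc k)) ≤ (l + 1) * ((k + l) C k)
length-complete-≤ k l = begin
  length (combinations (suc (k + l)) (suc k))               ≡⟨ length-combinations-suc (k + l) k ⟩
  D + length (combinations (k + l) (suc k))                 ≤⟨ +-monoʳ-≤ D (length-combinations-suc-≤ (k + l) k) ⟩
  D + (k + l ∸ k) * D                                       ≡⟨ cong (λ n → D + n * D) (m+n∸m≡n k l) ⟩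
  D + l * D                                                 ≡⟨ cong (λ n → n * D) (+-comm 1 l) ⟩
  (l + 1) * D                                               ≡⟨ cong ((l + 1) *_) (length-combinations (k + l) k) ⟩
  (l + 1) * ((k + l) C k)                                   ∎
  where
  open ≤-Reasoning
  D = length (combinations (k + l) k)

+-≤1 : ∀ {m n} → m ≤ 1 → n ≤ 1 → ¬ (1 ≤ m × 1 ≤ n) → m + n ≤ 1
+-≤1 z≤n       n≤1       _     = n≤1
+-≤1 (s≤s z≤n) z≤n       _     = s≤s z≤n
+-≤1 (s≤s z≤n) (s≤s z≤n) ¬both = ⊥-elim (¬both (s≤s z≤n , s≤s z≤n))

-- combinations n k has no repeated entries.
count-combinations-≤1 : ∀ n k (p : List (Fin n) → Bool) → (∀ {ys zs} → T (p ys) → T (p zs) → ys ≡ zs) →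
  count p (combinations n k) ≤ 1
count-combinations-≤1 n       zero    p _      = List.length-filter (T? ∘ p) [ [] ]
count-combinations-≤1 zero    (suc k) p _      = z≤n
count-combinations-≤1 (suc n) (suc k) p unique = begin
  count p (map with0 C₀ ++ map without0 C₁)           ≡⟨ count-++ p (map with0 C₀) (map without0 C₁) ⟩
  count p (map with0 C₀) + count p (map without0 C₁)  ≡⟨ cong₂ _+_ (count-map p with0 C₀) (count-map p without0 C₁) ⟩
  count (p ∘ with0) C₀ + count (p ∘ without0) C₁      ≤⟨ +-≤1 (count-combinations-≤1 n k (p ∘ with0) (with0-injective ∘₂ unique))
                                                            (count-combinations-≤1 n (suc k) (p ∘ without0) (without0-injective ∘₂ unique))
                                                            disjoint ⟩
  1                                                 ∎
  where
  open ≤-Reasoning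
  with0 without0 : List (Fin n) → List (Fin (suc n))
  with0 xs = zero ∷ map suc xs
  without0 = map suc
  C₀ = combinations n k
  C₁ = combinations n (suc k)
  with0-injective : ∀ {ys zs} → with0 ys ≡ with0 zs → ys ≡ zs
  with0-injective = List.map-injective Fin.suc-injective ∘ List.∷-injectiveʳ
  without0-injective : ∀ {ys zs} → without0 ys ≡ without0 zs → ys ≡ zs
  without0-injective = List.map-injective Fin.suc-injective
  with0≢without0 : ∀ ys zs → with0 ys ≢ without0 zs
  with0≢without0 ys []      ()
  with0≢without0 ys (_ ∷ _) ()
  disjoint : ¬ (1 ≤ count (p ∘ with0) C₀ × 1 ≤ count (p ∘ without0) C₁)
  disjoint (pos₀ , pos₁) =
    let ys , p₀ = count-pos⇒witness _ C₀ pos₀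
        zs , p₁ = count-pos⇒witness _ C₁ pos₁
    in  with0≢without0 ys zs (unique p₀ p₁)

-- The upper bound

≤-minDensity : ∀ {h} (E : List (List (Fin h))) (a : Fin h → ℕ) (G : BlowUp a) {q : ℚ} →
  q ℚ.≤ 1ℚ → All (λ e → q ℚ.≤ density a G e) E → q ℚ.≤ minDensity E a G
≤-minDensity []      a G q≤1 []         = q≤1
≤-minDensity (e ∷ E) a G q≤1 (q≤d ∷ q≤ds) = ℚ.⊓-glb q≤d (≤-minDensity E a G q≤1 q≤ds)

<-minDensity⇒All : ∀ {h} (E : List (List (Fin h))) (a : Fin h → ℕ) (G : BlowUp a) {q : ℚ} →
  q ℚ.< minDensity E a G → All (λ e → q ℚ.< density a G e) E
<-minDensity⇒All []      a G q<  = []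
<-minDensity⇒All (e ∷ E) a G q< =
  ℚ.<-≤-trans q< (ℚ.p⊓q≤p (density a G e) _) ∷ <-minDensity⇒All E a G (ℚ.<-≤-trans q< (ℚ.p⊓q≤q (density a G e) _))

not≡false⇒T : ∀ {b} → not b ≡ false → T b
not≡false⇒T {true}  _  = tt
not≡false⇒T {false} ()

module _ {h} (a : Fin h → ℕ) (a≥1 : ∀ i → 1 ≤ a i) (G : BlowUp a) where

  missing : Vec Bool h → Constraint a
  missing s = s , not ∘ G (members s)

  dense⇒few-violations : ∀ {N} → 1 ≤ N → (s : Vec Bool h) → 1ℚ - frac 1 N ℚ.< density a G (members s) →
    N * violations a (missing s) < #transversals a
  dense⇒few-violations {N} N≥1 s dense = begin-strict
    N * (b * outside a s)  ≡⟨ *-assoc N b (outside a s) ⟨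
    N * b * outside a s    <⟨ *-monoˡ-< (outside a s) {{>-nonZero (outside-pos a a≥1 s)}} N*b<P ⟩
    P * outside a s        ≡⟨ product-members*outside a s ⟩
    #transversals a        ∎
    where
    open ≤-Reasoning
    e = members s
    P = product (map a e)
    b = count (not ∘ G e) (allChoices a e)
    b≡P∸c : b ≡ P ∸ edgeCount a G e
    b≡P∸c = trans (sym (m+n∸n≡m b (edgeCount a G e)))
      (cong (_∸ edgeCount a G e) (trans (count-not+count (G e) (allChoices a e)) (length-allChoices a e)))
    N*b<P : N * b < P
    N*b<P = subst (λ n → N * n < P) (sym b≡P∸c) (1-1/N<c/P⇒N*[P∸c]<P N≥1 (product-pos a a≥1 e) dense)

  dense⇒transversal : (S : List (Vec Bool h)) {N : ℕ} → 1 ≤ N → length S ≤ N →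
    1ℚ - frac 1 N ℚ.< minDensity (map members S) a G → Σ (Transversal a) (HTransversal (map members S) a G)
  dense⇒transversal S N≥1 |S|≤N dense =
    let x , avoids = union-bound a (map missing S) few-violations
    in  x , All.map⁺ (All.map not≡false⇒T (All.map⁻ avoids))
    where
    few-violations : sum (map (violations a) (map missing S)) < #transversals a
    few-violations = all-*<⇒sum< (violations a) (map missing S) (#transversals-pos a a≥1)
      (subst (_≤ _) (sym (List.length-map missing S)) |S|≤N)
      (All.map⁺ (All.map (λ {s} → dense⇒few-violations N≥1 s) (All.map⁻ (<-minDensity⇒All (map members S) a G dense))))

crit≤1-1/N : ∀ {h} (S : List (Vec Bool h)) {N : ℕ} → 1 ≤ N → length S ≤ N →
  CritAtMost (map members S) (1ℚ - frac 1 N)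
crit≤1-1/N S {N} N≥1 |S|≤N a a≥1 G free with minDensity (map members S) a G ℚ.≤? 1ℚ - frac 1 N
... | yes d≤ = d≤
... | no  d≰ = ⊥-elim (free (dense⇒transversal a a≥1 G S N≥1 |S|≤N (ℚ.≰⇒> d≰)))

upper-bound : ∀ k l → CritAtMost (combinations (suc (k + l)) (suc k)) (1ℚ - frac 1 ((l + 1) * ((k + l) C k)))
upper-bound k l = subst (λ E → CritAtMost E (1ℚ - frac 1 N)) (sym E≡)
  (crit≤1-1/N (subsets (suc (k + l)) (suc k)) N≥1 |S|≤N)
  where
  N = (l + 1) * ((k + l) C k)
  E≡ = combinations≡map-members (suc (k + l)) (suc k)
  N≥1 : 1 ≤ N
  N≥1 = *-mono-≤ (m≤n+m 1 l)
    (subst (1 ≤_) (length-combinations (k + l) k) (length-combinations-pos (m≤m+n k l)))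
  |S|≤N : length (subsets (suc (k + l)) (suc k)) ≤ N
  |S|≤N = subst (_≤ N) (trans (cong length E≡) (List.length-map members (subsets (suc (k + l)) (suc k)))) (length-complete-≤ k l)

-- The lower bound

-- The blow-up of the complete (k+1)-graph on vertices 0, 1, …, k + l in which every class but
-- that of 0 is a single vertex, and the class of 0 has a vertex j for each k-set S_j
-- (j-th entry of `links`) of other vertices: G omits exactly the edge of G[{0} ∪ S_j] through j.
module Construction (k l : ℕ) where

  links : List (List (Fin (k + l)))
  links = combinations (k + l) k

  D : ℕ
  D = length links

  D≥1 : 1 ≤ D
  D≥1 = length-combinations-pos (m≤m+n k l)

  sizes : Fin (suc (k + l)) → ℕ
  sizes zero    = D
  sizes (suc _) = 1

  sizes≥1 : ∀ i → 1 ≤ sizes i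
  sizes≥1 zero    = D≥1
  sizes≥1 (suc _) = s≤s z≤n

  _≟ᴸ_ : DecidableEquality (List (Fin (suc (k + l))))
  _≟ᴸ_ = List.≡-dec Fin._≟_

  G : BlowUp sizes
  G (zero ∷ rest) (j , _) = not ⌊ rest ≟ᴸ map suc (lookup links j) ⌋
  G _             _       = true

  E : List (List (Fin (suc (k + l))))
  E = combinations (suc (k + l)) (suc k)

  misses-own-edge : ∀ j c → ¬ T (G (zero ∷ map suc (lookup links j)) (j , c))
  misses-own-edge j c with map suc (lookup links j) ≟ᴸ map suc (lookup links j)
  ... | yes _   = λ ()
  ... | no  e≢e = ⊥-elim (e≢e refl)

  free : HFree E sizes G
  free (x , edges) = misses-own-edge (x zero) (restrict sizes x (map suc (lookup links (x zero))))
    (All.lookup edges (∈-++⁺ˡ (∈-map⁺ (λ xs → zero ∷ map suc xs) (∈-lookup {xs = links} (x zero)))))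

  product-map-suc≡1 : ∀ ys → product (map sizes (map suc ys)) ≡ 1
  product-map-suc≡1 []       = refl
  product-map-suc≡1 (_ ∷ ys) = trans (+-identityʳ _) (product-map-suc≡1 ys)

  edgeCount-avoiding-0 : ∀ ys → edgeCount sizes G (map suc ys) ≡ 1
  edgeCount-avoiding-0 []       = refl
  edgeCount-avoiding-0 (y ∷ ys) = trans (count-const true (allChoices sizes (map suc (y ∷ ys))))
    (trans (length-allChoices sizes (map suc (y ∷ ys))) (product-map-suc≡1 (y ∷ ys)))

  density-avoiding-0 : ∀ ys → 1ℚ - frac 1 D ℚ.≤ density sizes G (map suc ys)
  density-avoiding-0 ys = subst (1ℚ - frac 1 D ℚ.≤_)
    (sym (cong₂ frac (edgeCount-avoiding-0 ys) (product-map-suc≡1 ys))) (1-1/D≤1 D)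

  module _ (xs : List (Fin (k + l))) where

    matches : Fin D → Bool
    matches j = ⌊ map suc xs ≟ᴸ map suc (lookup links j) ⌋

    matches≤1 : count matches (allFin D) ≤ 1
    matches≤1 = subst (_≤ 1)
      (trans (cong (count p) (sym (trans (List.map-tabulate id (lookup links)) (List.tabulate-lookup links))))
             (count-map p (lookup links) (allFin D)))
      (count-combinations-≤1 (k + l) k p unique)
      where
      p : List (Fin (k + l)) → Bool
      p ys = ⌊ map suc xs ≟ᴸ map suc ys ⌋
      unique : ∀ {ys zs} → T (p ys) → T (p zs) → ys ≡ zs
      unique {ys} {zs} t t′ = List.map-injective Fin.suc-injective
        (trans (sym (toWitness {a? = map suc xs ≟ᴸ map suc ys} t)) (toWitness {a? = map suc xs ≟ᴸ map suc zs} t′))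

    edgeCount-through-0 : edgeCount sizes G (zero ∷ map suc xs) ≡ count (not ∘ matches) (allFin D)
    edgeCount-through-0 = begin
      edgeCount sizes G (zero ∷ map suc xs)
        ≡⟨ count-allChoices-∷ sizes zero (map suc xs) (G (zero ∷ map suc xs)) ⟩
      sum (map (λ j → count (λ _ → not (matches j)) (allChoices sizes (map suc xs))) (allFin D))
        ≡⟨ sum-count-const (not ∘ matches) (allFin D) (allChoices sizes (map suc xs)) ⟩
      count (not ∘ matches) (allFin D) * length (allChoices sizes (map suc xs))
        ≡⟨ cong (count (not ∘ matches) (allFin D) *_)
                (trans (length-allChoices sizes (map suc xs)) (product-map-suc≡1 xs)) ⟩
      count (not ∘ matches) (allFin D) * 1
        ≡⟨ *-identityʳ _ ⟩
      count (not ∘ matches) (allFin D) ∎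
      where open ≡-Reasoning

    density-through-0 : 1ℚ - frac 1 D ℚ.≤ density sizes G (zero ∷ map suc xs)
    density-through-0 = subst (1ℚ - frac 1 D ℚ.≤_)
      (sym (cong₂ frac edgeCount-through-0 (trans (cong (D *_) (product-map-suc≡1 xs)) (*-identityʳ D))))
      (1-1/D≤c/D D≥1 D≤1+kept)
      where
      D≤1+kept : D ≤ suc (count (not ∘ matches) (allFin D))
      D≤1+kept = begin
        D                                                             ≡⟨ List.length-tabulate {n = D} id ⟨
        length (allFin D)                                             ≡⟨ count-not+count matches (allFin D) ⟨
        count (not ∘ matches) (allFin D) + count matches (allFin D)   ≤⟨ +-monoʳ-≤ _ matches≤1 ⟩
        count (not ∘ matches) (allFin D) + 1                          ≡⟨ +-comm _ 1 ⟩
        suc (count (not ∘ matches) (allFin D))                        ∎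
        where open ≤-Reasoning

  1-1/D≤minDensity : 1ℚ - frac 1 D ℚ.≤ minDensity E sizes G
  1-1/D≤minDensity = ≤-minDensity E sizes G (1-1/D≤1 D)
    (All.++⁺ (All.map⁺ (All.universal density-through-0 links))
             (All.map⁺ (All.universal density-avoiding-0 (combinations (k + l) (suc k)))))

lower-bound : ∀ k l → CritAtLeast (combinations (suc (k + l)) (suc k)) (1ℚ - frac 1 ((k + l) C k))
lower-bound k l ε ε>0 = sizes , sizes≥1 , G , free ,
  ℚ.<-≤-trans (p-ε<p _ ε ε>0) (subst (λ n → 1ℚ - frac 1 n ℚ.≤ minDensity E sizes G) (length-combinations (k + l) k) 1-1/D≤minDensity)
  where open Construction k l

-- Both bounds hold for all k ≥ 1 and l ≥ 0.
theorem5 : (k l : ℕ) → 2 ≤ k → 1 ≤ l → l < k →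
    CritAtLeast (completeEdges (k + l) k) (1ℚ - frac 1 ((k + l ∸ 1) C (k ∸ 1)))
    × CritAtMost (completeEdges (k + l) k) (1ℚ - frac 1 ((l + 1) * ((k + l ∸ 1) C (k ∸ 1))))
theorem5 (suc k) l _ _ _ = lower-bound k l , upper-bound k l
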